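{- There is a function $r$ defined on the integers $n \ge 6$ that are not perfect squares, with $r(n) \ge 1$ and $r(n) \to 1$ as $n \to \infty$, with the following property. For every integer $n \ge 6$ that is not a perfect square, some square can be tiled by exactly $n$ smaller squares that have exactly two different side lengths, and the ratio of the larger side length to the smaller one is $r(n)$.
   Context: A tiling (decomposition) of a square $S$ by squares is a finite collection of squares with pairwise disjoint interiors whose union is $S$. -}

module Defs where

open import Data.Nat using (ℕ) renaming (_*_ to _*ℕ_)
open import Data.Rational using (ℚ; _≤_; _<_; _+_; 0ℚ)
open import Data.Fin using (Fin)
open import Data.Product using (Σ; ∃; _×_; _,_)
open import Relation.Binary.PropositionalEquality using (_≡_; _≢_)
open import Relation.Nullary using (¬_)

IsPerfectSquare : ℕ → Set
IsPerfectSquare n = ∃ λ k → k *ℕ k ≡ n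

-- An axis-parallel square with lower-left corner (x , y) and side length `side`.
record Square : Set where
  constructor square
  field
    x y side : ℚ
open Square public

Point : Set
Point = ℚ × ℚ

_∈ₛ_ : Point → Square → Set
(p , q) ∈ₛ S = (x S ≤ p × p ≤ x S + side S) × (y S ≤ q × q ≤ y S + side S)

_∈°_ : Point → Square → Set
(p , q) ∈° S = (x S < p × p < x S + side S) × (y S < q × q < y S + side S)

IsTiling : Square → {m : ℕ} → (Fin m → Square) → Set
IsTiling S {m} T =
    (∀ i → 0ℚ < side (T i))
  × (∀ i p → p ∈ₛ T i → p ∈ₛ S)
  × (∀ p → p ∈ₛ S → ∃ λ i → p ∈ₛ T i)
  × (∀ i j → i ≢ j → ∀ p → ¬ (p ∈° T i × p ∈° T j))

{-# OPTIONS --safe #-}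
-- Take L = s·d + U = d + V. The square of side L·l splits into a strip of height d·l, holding an
-- (s·l) × l grid of d-squares next to a U × d grid of l-squares, below an L × V grid of l-squares;
-- these are s·l² + U·d + L·V = L² + s(l² − d²) squares of sides d and l. For m² < n < (m+1)², write
-- n = m² + e if n − m² > m and n = (m+1)² − e otherwise, so that m < e ≤ 2m, and realise e as
-- s((b+δ)² − b²) with (s, δ) = (1, 1), (2, 1) or (1, 2) according to e mod 4; then take L = m and
-- (d, l) = (b, b+δ) in the first case, L = m+1 and (d, l) = (b+δ, b) in the second. As b ≥ e/4 − 1
-- grows like √n while δ ≤ 2, the ratio (b+δ)/b tends to 1. Only n = 8, 12, 13 would force b = 0;
-- they get layouts of their own.
module Submission where

module Embedding where

  open import Data.Nat using (ℕ; _+_; _≤_; _<_)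
  open import Data.Rational as ℚ using (ℚ)
  open import Data.Rational.Literals using (fromℤ)
  import Data.Rational.Properties as ℚₚ
  import Data.Rational.Unnormalised as ℚᵘ
  import Data.Rational.Unnormalised.Properties as ℚᵘₚ
  import Data.Integer as ℤ
  import Data.Integer.Properties as ℤₚ
  open import Relation.Binary.PropositionalEquality

  ι : ℕ → ℚ
  ι n = fromℤ (ℤ.+ n)

  ι-+ : ∀ m n → ι (m + n) ≡ ι m ℚ.+ ι n
  ι-+ m n = ℚₚ.toℚᵘ-injective (ℚᵘₚ.≃-trans (ℚᵘ.*≡* eq) (ℚᵘₚ.≃-sym (ℚₚ.toℚᵘ-homo-+ (ι m) (ι n))))
    where
    eq : ℤ.+ (m + n) ℤ.* ℤ.+ 1 ≡ (ℤ.+ m ℤ.* ℤ.+ 1 ℤ.+ ℤ.+ n ℤ.* ℤ.+ 1) ℤ.* ℤ.+ 1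
    eq = trans (ℤₚ.*-identityʳ _) (trans (ℤₚ.pos-+ m n) (sym (trans (ℤₚ.*-identityʳ _)
           (cong₂ ℤ._+_ (ℤₚ.*-identityʳ (ℤ.+ m)) (ℤₚ.*-identityʳ (ℤ.+ n))))))

  ι-mono-≤ : ∀ {m n} → m ≤ n → ι m ℚ.≤ ι n
  ι-mono-≤ {m} {n} m≤n =
    ℚ.*≤* (subst₂ ℤ._≤_ (sym (ℤₚ.*-identityʳ (ℤ.+ m))) (sym (ℤₚ.*-identityʳ (ℤ.+ n))) (ℤ.+≤+ m≤n))

  ι-mono-< : ∀ {m n} → m < n → ι m ℚ.< ι n
  ι-mono-< {m} {n} m<n =
    ℚ.*<* (subst₂ ℤ._<_ (sym (ℤₚ.*-identityʳ (ℤ.+ m))) (sym (ℤₚ.*-identityʳ (ℤ.+ n))) (ℤ.+<+ m<n))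

module RectangleTilings where

  open import Defs
  open import Data.Nat
  open import Data.Nat.Properties
  open import Data.Rational as ℚ using (0ℚ)
  import Data.Rational.Properties as ℚₚ
  open import Data.Fin as Fin using (Fin; splitAt; _↑ˡ_; _↑ʳ_)
  open import Data.Fin.Properties using (splitAt-↑ˡ; splitAt-↑ʳ; splitAt⁻¹-↑ˡ; splitAt⁻¹-↑ʳ)
  open import Data.Product using (∃; _×_; _,_; proj₁; proj₂; swap)
  open import Data.Sum using (inj₁; inj₂; [_,_]′)
  open import Data.Empty using (⊥-elim)
  open import Function using (_∘_)
  open import Relation.Binary.PropositionalEquality
  open import Relation.Nullary using (¬_; yes; no)
  open Embedding

  record Tile : Set where
    constructor tile
    field
      left bottom size : ℕ
  open Tile public

  ⟦_⟧ : Tile → Square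
  ⟦ t ⟧ = square (ι (left t)) (ι (bottom t)) (ι (size t))

  WithinRect : ℕ → ℕ → ℕ → ℕ → Tile → Set
  WithinRect x y w h t = (x ≤ left t × left t + size t ≤ x + w) × (y ≤ bottom t × bottom t + size t ≤ y + h)

  InRect : ℕ → ℕ → ℕ → ℕ → Point → Set
  InRect x y w h (p , q) = (ι x ℚ.≤ p × p ℚ.≤ ι (x + w)) × (ι y ℚ.≤ q × q ℚ.≤ ι (y + h))

  record Tiling (ok : ℕ → Set) (x y w h m : ℕ) : Set where
    field
      tiles    : Fin m → Tile
      sizes-ok : ∀ i → ok (size (tiles i))
      positive : ∀ i → 0 < size (tiles i)
      within   : ∀ i → WithinRect x y w h (tiles i)
      covers   : ∀ p → InRect x y w h p → ∃ λ i → p ∈ₛ ⟦ tiles i ⟧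
      disjoint : ∀ i j → i ≢ j → ∀ p → ¬ (p ∈° ⟦ tiles i ⟧ × p ∈° ⟦ tiles j ⟧)
  open Tiling public

  Has : ∀ {ok x y w h m} → ℕ → Tiling ok x y w h m → Set
  Has c t = ∃ λ i → size (tiles t i) ≡ c

  single : ∀ {ok : ℕ → Set} x y c → 0 < c → ok c → Tiling ok x y c c 1
  single x y c 0<c ok-c = record
    { tiles    = λ _ → tile x y c
    ; sizes-ok = λ _ → ok-c
    ; positive = λ _ → 0<c
    ; within   = λ _ → (≤-refl , ≤-refl) , (≤-refl , ≤-refl)
    ; covers   = λ { (p , q) ((x≤p , p≤) , (y≤q , q≤)) →
                     Fin.zero , (x≤p , subst (p ℚ.≤_) (ι-+ x c) p≤) , (y≤q , subst (q ℚ.≤_) (ι-+ y c) q≤) }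
    ; disjoint = λ { Fin.zero Fin.zero 0≢0 → ⊥-elim (0≢0 refl) }
    }

  module _ {ok : ℕ → Set} {x y w₁ w₂ h m₁ m₂ : ℕ}
           (t₁ : Tiling ok x y w₁ h m₁) (t₂ : Tiling ok (x + w₁) y w₂ h m₂) where

    private
      T : Fin (m₁ + m₂) → Tile
      T = [ tiles t₁ , tiles t₂ ]′ ∘ splitAt m₁

      every : {P : Tile → Set} → (∀ k → P (tiles t₁ k)) → (∀ k → P (tiles t₂ k)) → ∀ i → P (T i)
      every f g i with splitAt m₁ i
      ... | inj₁ k = f k
      ... | inj₂ k = g k

      x+w₁+w₂ : x + w₁ + w₂ ≡ x + (w₁ + w₂)
      x+w₁+w₂ = +-assoc x w₁ w₂

      within-beside : ∀ i → WithinRect x y (w₁ + w₂) h (T i)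
      within-beside i with splitAt m₁ i
      ... | inj₁ k = let ((x≤ , ≤x+w₁) , vertical) = within t₁ k in
        (x≤ , ≤-trans ≤x+w₁ (subst (x + w₁ ≤_) x+w₁+w₂ (m≤m+n (x + w₁) w₂))) , vertical
      ... | inj₂ k = let ((x+w₁≤ , ≤x+w₁+w₂) , vertical) = within t₂ k in
        (≤-trans (m≤m+n x w₁) x+w₁≤ , subst (left (tiles t₂ k) + size (tiles t₂ k) ≤_) x+w₁+w₂ ≤x+w₁+w₂)
        , vertical

      covers-beside : ∀ p → InRect x y (w₁ + w₂) h p → ∃ λ i → p ∈ₛ ⟦ T i ⟧
      covers-beside (p , q) ((x≤p , p≤) , vertical) with p ℚₚ.≤? ι (x + w₁)
      ... | yes p≤x+w₁ =
        let (k , p∈) = covers t₁ (p , q) ((x≤p , p≤x+w₁) , vertical)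
        in k ↑ˡ m₂ , subst (λ i → (p , q) ∈ₛ ⟦ [ tiles t₁ , tiles t₂ ]′ i ⟧) (sym (splitAt-↑ˡ m₁ k m₂)) p∈
      ... | no p≰x+w₁ =
        let x+w₁≤p = ℚₚ.<⇒≤ (ℚₚ.≰⇒> p≰x+w₁)
            (k , p∈) = covers t₂ (p , q) ((x+w₁≤p , subst (λ z → p ℚ.≤ ι z) (sym x+w₁+w₂) p≤) , vertical)
        in m₁ ↑ʳ k , subst (λ i → (p , q) ∈ₛ ⟦ [ tiles t₁ , tiles t₂ ]′ i ⟧) (sym (splitAt-↑ʳ m₁ m₂ k)) p∈

      separated : ∀ k k′ p → ¬ (p ∈° ⟦ tiles t₁ k ⟧ × p ∈° ⟦ tiles t₂ k′ ⟧)
      separated k k′ (p , q) (((_ , p<) , _) , ((<p , _) , _)) = ℚₚ.<-irrefl refl (ℚₚ.<-trans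
        (ℚₚ.<-≤-trans (subst (p ℚ.<_) (sym (ι-+ (left (tiles t₁ k)) (size (tiles t₁ k)))) p<)
                      (ι-mono-≤ (proj₂ (proj₁ (within t₁ k)))))
        (ℚₚ.≤-<-trans (ι-mono-≤ (proj₁ (proj₁ (within t₂ k′)))) <p))

      disjoint-beside : ∀ i j → i ≢ j → ∀ p → ¬ (p ∈° ⟦ T i ⟧ × p ∈° ⟦ T j ⟧)
      disjoint-beside i j i≢j p with splitAt m₁ i in eqi | splitAt m₁ j in eqj
      ... | inj₁ k | inj₁ k′ = disjoint t₁ k k′ (λ k≡k′ → i≢j
              (trans (sym (splitAt⁻¹-↑ˡ eqi)) (trans (cong (_↑ˡ m₂) k≡k′) (splitAt⁻¹-↑ˡ eqj)))) p
      ... | inj₂ k | inj₂ k′ = disjoint t₂ k k′ (λ k≡k′ → i≢j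
              (trans (sym (splitAt⁻¹-↑ʳ eqi)) (trans (cong (m₁ ↑ʳ_) k≡k′) (splitAt⁻¹-↑ʳ eqj)))) p
      ... | inj₁ k | inj₂ k′ = separated k k′ p
      ... | inj₂ k | inj₁ k′ = λ (p∈j , p∈i) → separated k′ k p (p∈i , p∈j)

    beside : Tiling ok x y (w₁ + w₂) h (m₁ + m₂)
    beside = record
      { tiles    = T
      ; sizes-ok = every {ok ∘ size} (sizes-ok t₁) (sizes-ok t₂)
      ; positive = every {λ t → 0 < size t} (positive t₁) (positive t₂)
      ; within   = within-beside
      ; covers   = covers-beside
      ; disjoint = disjoint-beside
      }

    has-besideˡ : ∀ {c} → Has c t₁ → Has c beside
    has-besideˡ (k , size≡c) =
      k ↑ˡ m₂ , trans (cong (size ∘ [ tiles t₁ , tiles t₂ ]′) (splitAt-↑ˡ m₁ k m₂)) size≡c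

    has-besideʳ : ∀ {c} → Has c t₂ → Has c beside
    has-besideʳ (k , size≡c) =
      m₁ ↑ʳ k , trans (cong (size ∘ [ tiles t₁ , tiles t₂ ]′) (splitAt-↑ʳ m₁ m₂ k)) size≡c

  transpose : ∀ {ok x y w h m} → Tiling ok x y w h m → Tiling ok y x h w m
  transpose t = record
    { tiles    = λ i → let tile a b c = tiles t i in tile b a c
    ; sizes-ok = sizes-ok t
    ; positive = positive t
    ; within   = λ i → swap (within t i)
    ; covers   = λ (p , q) pq∈ → let (i , qp∈) = covers t (q , p) (swap pq∈) in i , swap qp∈
    ; disjoint = λ i j i≢j (p , q) (p∈i , p∈j) → disjoint t i j i≢j (q , p) (swap p∈i , swap p∈j)
    }

  module _ {ok : ℕ → Set} {x y w h₁ h₂ m₁ m₂ : ℕ}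
           (t₁ : Tiling ok x y w h₁ m₁) (t₂ : Tiling ok x (y + h₁) w h₂ m₂) where

    above : Tiling ok x y w (h₁ + h₂) (m₁ + m₂)
    above = transpose (beside (transpose t₁) (transpose t₂))

    has-aboveˡ : ∀ {c} → Has c t₁ → Has c above
    has-aboveˡ = has-besideˡ (transpose t₁) (transpose t₂)

    has-aboveʳ : ∀ {c} → Has c t₂ → Has c above
    has-aboveʳ = has-besideʳ (transpose t₁) (transpose t₂)

  reshape : ∀ {ok x y w h m w′ h′} → w ≡ w′ → h ≡ h′ → Tiling ok x y w h m → Tiling ok x y w′ h′ m
  reshape {x = x} {y} w≡w′ h≡h′ t = record
    { tiles    = tiles t
    ; sizes-ok = sizes-ok t
    ; positive = positive t
    ; within   = subst₂ (λ w h → ∀ i → WithinRect x y w h (tiles t i)) w≡w′ h≡h′ (within t)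
    ; covers   = subst₂ (λ w h → ∀ p → InRect x y w h p → ∃ λ i → p ∈ₛ ⟦ tiles t i ⟧) w≡w′ h≡h′ (covers t)
    ; disjoint = disjoint t
    }

  recount : ∀ {ok x y w h m m′} → m ≡ m′ → Tiling ok x y w h m → Tiling ok x y w h m′
  recount refl t = t

  weaken : ∀ {ok ok′ : ℕ → Set} {x y w h m} → (∀ {c} → ok c → ok′ c) → Tiling ok x y w h m → Tiling ok′ x y w h m
  weaken ok⇒ok′ t = record
    { tiles    = tiles t
    ; sizes-ok = ok⇒ok′ ∘ sizes-ok t
    ; positive = positive t
    ; within   = within t
    ; covers   = covers t
    ; disjoint = disjoint t
    }

  has-uniform : ∀ {c x y w h m} (t : Tiling (_≡ c) x y w h (suc m)) → Has c t
  has-uniform t = Fin.zero , sizes-ok t Fin.zero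

  column : ∀ x y c → 0 < c → ∀ q → Tiling (_≡ c) x y c (suc q * c) (suc q)
  column x y c 0<c zero    = reshape refl (sym (+-identityʳ c)) (single x y c 0<c refl)
  column x y c 0<c (suc q) = above (single x y c 0<c refl) (column x (y + c) c 0<c q)

  grid : ∀ x y c → 0 < c → ∀ p q → Tiling (_≡ c) x y (suc p * c) (suc q * c) (suc p * suc q)
  grid x y c 0<c zero    q =
    reshape (sym (+-identityʳ c)) refl (recount (sym (+-identityʳ (suc q))) (column x y c 0<c q))
  grid x y c 0<c (suc p) q = beside (column x y c 0<c q) (grid (x + c) y c 0<c p q)

  isTiling : ∀ {ok Z m} (t : Tiling ok 0 0 Z Z m) → IsTiling (square 0ℚ 0ℚ (ι Z)) (⟦_⟧ ∘ tiles t)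
  isTiling {Z = Z} t = ι-mono-< ∘ positive t , tiles⊆square , square⊆tiles , disjoint t
    where
    0+Z≡Z : 0ℚ ℚ.+ ι Z ≡ ι Z
    0+Z≡Z = ℚₚ.+-identityˡ (ι Z)

    below-Z : ∀ {p} u c → u + c ≤ Z → p ℚ.≤ ι u ℚ.+ ι c → p ℚ.≤ 0ℚ ℚ.+ ι Z
    below-Z {p} u c u+c≤Z p≤ = subst (p ℚ.≤_) (sym 0+Z≡Z)
      (ℚₚ.≤-trans p≤ (subst (ℚ._≤ ι Z) (ι-+ u c) (ι-mono-≤ u+c≤Z)))

    tiles⊆square : ∀ i p → p ∈ₛ ⟦ tiles t i ⟧ → p ∈ₛ square 0ℚ 0ℚ (ι Z)
    tiles⊆square i (p , q) ((u≤p , p≤) , (v≤q , q≤)) =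
      let tile u v c = tiles t i
          ((_ , u+c≤Z) , (_ , v+c≤Z)) = within t i
      in (ℚₚ.≤-trans (ι-mono-≤ (z≤n {u})) u≤p , below-Z u c u+c≤Z p≤)
       , (ℚₚ.≤-trans (ι-mono-≤ (z≤n {v})) v≤q , below-Z v c v+c≤Z q≤)

    square⊆tiles : ∀ p → p ∈ₛ square 0ℚ 0ℚ (ι Z) → ∃ λ i → p ∈ₛ ⟦ tiles t i ⟧
    square⊆tiles (p , q) ((0≤p , p≤) , (0≤q , q≤)) =
      covers t (p , q) ((0≤p , subst (p ℚ.≤_) 0+Z≡Z p≤) , (0≤q , subst (q ℚ.≤_) 0+Z≡Z q≤))

module TwoSizeLayout where

  open import Data.Nat
  open import Data.Nat.Properties
  open import Data.Nat.Tactic.RingSolver using (solve)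
  open import Data.List using (_∷_; [])
  open import Data.Product using (Σ; _,_; proj₁; proj₂)
  open import Data.Sum as ⊎ using (_⊎_; inj₁; inj₂)
  open import Relation.Binary.PropositionalEquality
  open RectangleTilings

  record TwoSizeTiling (a b Z n : ℕ) : Set where
    field
      tiling : Tiling (λ c → c ≡ a ⊎ c ≡ b) 0 0 Z Z n
      has-a  : Has a tiling
      has-b  : Has b tiling

  swap-sizes : ∀ {a b Z n} → TwoSizeTiling a b Z n → TwoSizeTiling b a Z n
  swap-sizes t = record { tiling = weaken ⊎.swap tiling ; has-a = has-b ; has-b = has-a }
    where open TwoSizeTiling t

  strip-width : ∀ s l d U {L} → s * d + U ≡ L → s * l * d + U * l ≡ L * l
  strip-width s l d U {L} sd+U≡L = begin
    s * l * d + U * l ≡⟨ solve (s ∷ l ∷ d ∷ U ∷ []) ⟩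
    (s * d + U) * l   ≡⟨ cong (_* l) sd+U≡L ⟩
    L * l             ∎
    where open ≡-Reasoning

  layout : ∀ s d l U V .{{_ : NonZero s}} .{{_ : NonZero d}} .{{_ : NonZero l}} .{{_ : NonZero V}} →
           s * d + U ≡ d + V →
           TwoSizeTiling d l ((d + V) * l) (s * l * l + U * d + (d + V) * V)
  layout s@(suc s′) d@(suc d′) l@(suc l′) U V@(suc V′) sd+U≡d+V = record
    { tiling = reshape refl (sym (*-distribʳ-+ l d V)) (above (proj₁ lower) upper)
    ; has-a  = has-aboveˡ (proj₁ lower) upper (proj₂ lower)
    ; has-b  = has-aboveʳ (proj₁ lower) upper (has-uniform l-grid)
    }
    where
    Sizes : ℕ → Set
    Sizes c = c ≡ d ⊎ c ≡ l

    block : Tiling (_≡ d) 0 0 (s * l * d) (d * l) (s * l * l)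
    block = reshape refl (*-comm l d) (grid 0 0 d z<s (l′ + s′ * l) l′)

    lower-strip : ∀ U → s * d + U ≡ d + V →
                  Σ (Tiling Sizes 0 0 ((d + V) * l) (d * l) (s * l * l + U * d)) (Has d)
    lower-strip zero sd≡d+V =
      let block′ = recount (sym (+-identityʳ _)) block in
      reshape (trans (sym (+-identityʳ _)) (strip-width s l d 0 sd≡d+V)) refl (weaken inj₁ block′)
      , has-uniform block′
    lower-strip (suc u) sd+U≡d+V =
      let right = grid (s * l * d) 0 l z<s u d′ in
      reshape (strip-width s l d (suc u) sd+U≡d+V) refl (beside (weaken inj₁ block) (weaken inj₂ right))
      , has-besideˡ (weaken inj₁ block) (weaken inj₂ right) (has-uniform block)

    lower : Σ (Tiling Sizes 0 0 ((d + V) * l) (d * l) (s * l * l + U * d)) (Has d)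
    lower = lower-strip U sd+U≡d+V

    l-grid : Tiling (_≡ l) 0 (d * l) ((d + V) * l) (V * l) ((d + V) * V)
    l-grid = grid 0 (d * l) l z<s (d′ + V) V′

    upper : Tiling Sizes 0 (d * l) ((d + V) * l) (V * l) ((d + V) * V)
    upper = weaken inj₂ l-grid

  tile-count : ∀ {n L} s d l U V → s * d + U ≡ L → d + V ≡ L → n + s * d * d ≡ L * L + s * l * l →
               s * l * l + U * d + (d + V) * V ≡ n
  tile-count {n} {L} s d l U V sd+U≡L d+V≡L n+sd²≡L²+sl² = +-cancelʳ-≡ (s * d * d) _ n (begin
    s * l * l + U * d + (d + V) * V + s * d * d ≡⟨ solve (s ∷ d ∷ l ∷ U ∷ V ∷ []) ⟩
    s * l * l + ((s * d + U) * d + (d + V) * V) ≡⟨ cong₂ (λ a b → s * l * l + (a * d + b * V)) sd+U≡L d+V≡L ⟩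
    s * l * l + (L * d + L * V)                 ≡⟨ cong (s * l * l +_) (*-distribˡ-+ L d V) ⟨
    s * l * l + L * (d + V)                     ≡⟨ cong (λ a → s * l * l + L * a) d+V≡L ⟩
    s * l * l + L * L                           ≡⟨ +-comm (s * l * l) (L * L) ⟩
    L * L + s * l * l                           ≡⟨ n+sd²≡L²+sl² ⟨
    n + s * d * d                               ∎)
    where open ≡-Reasoning

  two-size-square : ∀ {n L} s d l .{{_ : NonZero s}} .{{_ : NonZero d}} .{{_ : NonZero l}} →
                    s * d ≤ L → d < L → n + s * d * d ≡ L * L + s * l * l → TwoSizeTiling d l (L * l) n
  two-size-square {n} {L} s d l sd≤L d<L n+sd²≡L²+sl² =
    subst₂ (TwoSizeTiling d l) (cong (_* l) d+V≡L)
           (tile-count s d l U V (m+[n∸m]≡n sd≤L) d+V≡L n+sd²≡L²+sl²)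
           (layout s d l U V (trans (m+[n∸m]≡n sd≤L) (sym d+V≡L)))
    where
    U V : ℕ
    U = L ∸ s * d
    V = L ∸ d
    d+V≡L : d + V ≡ L
    d+V≡L = m+[n∸m]≡n (<⇒≤ d<L)
    instance
      V≢0 : NonZero V
      V≢0 = >-nonZero (m<n⇒0<n∸m d<L)

module Ratios where

  open import Data.Nat as ℕ using (ℕ; zero; suc)
  import Data.Nat.Properties as ℕₚ
  import Data.Nat.Tactic.RingSolver as ℕ-Solver
  import Data.Integer as ℤ
  import Data.Integer.Properties as ℤₚ
  open import Data.Rational
  open import Data.Rational.Properties
  import Data.Rational.Unnormalised as ℚᵘ
  import Data.Rational.Unnormalised.Properties as ℚᵘₚ
  open import Data.Rational.Solver using (module +-*-Solver)
  open import Data.List using (_∷_; [])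
  open import Data.Product using (∃; _,_)
  open import Relation.Binary.PropositionalEquality
  open Embedding

  ratio : ℕ → ℕ → ℚ
  ratio p zero      = 0ℚ  -- junk
  ratio p q@(suc _) = ι p ÷ ι q

  ι≡ratio*ι : ∀ p q .{{_ : ℕ.NonZero q}} → ι p ≡ ratio p q * ι q
  ι≡ratio*ι p q@(suc _) = sym (begin
    ι p * 1/ ι q * ι q   ≡⟨ *-assoc (ι p) (1/ ι q) (ι q) ⟩
    ι p * (1/ ι q * ι q) ≡⟨ cong (ι p *_) (*-inverseˡ (ι q)) ⟩
    ι p * 1ℚ             ≡⟨ *-identityʳ (ι p) ⟩
    ι p                  ∎)
    where open ≡-Reasoning

  1≤ratio : ∀ {p q} .{{_ : ℕ.NonZero q}} → q ℕ.≤ p → 1ℚ ≤ ratio p q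
  1≤ratio {p} {q@(suc _)} q≤p =
    subst (_≤ ι p * 1/ ι q) (*-inverseʳ (ι q)) (*-monoʳ-≤-nonNeg (1/ ι q) (ι-mono-≤ q≤p))

  ratio[q+δ,q]-1≡ratio[δ,q] : ∀ q δ .{{_ : ℕ.NonZero q}} → ratio (q ℕ.+ δ) q - 1ℚ ≡ ratio δ q
  ratio[q+δ,q]-1≡ratio[δ,q] q@(suc _) δ = begin
    ι (q ℕ.+ δ) * u - 1ℚ     ≡⟨ cong (λ a → a * u - 1ℚ) (ι-+ q δ) ⟩
    (ι q + ι δ) * u - 1ℚ     ≡⟨ solve 3 (λ a b u → (a :+ b) :* u :- con 1ℚ := b :* u :+ (a :* u :- con 1ℚ))
                                  refl (ι q) (ι δ) u ⟩
    ι δ * u + (ι q * u - 1ℚ) ≡⟨ cong (λ a → ι δ * u + (a - 1ℚ)) (*-inverseʳ (ι q)) ⟩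
    ι δ * u + (1ℚ - 1ℚ)      ≡⟨ cong (ι δ * u +_) (+-inverseʳ 1ℚ) ⟩
    ι δ * u + 0ℚ             ≡⟨ +-identityʳ (ι δ * u) ⟩
    ι δ * u                  ∎
    where
    open ≡-Reasoning
    open +-*-Solver
    u : ℚ
    u = 1/ ι q

  -- ε = (1 + a) / (1 + d) ≥ 1 / (1 + d), so K = 1 + d will do.
  archimedean : ∀ ε → 0ℚ < ε → ∃ λ K → ∀ p q → K ℕ.* p ℕ.< q → ratio p q < ε
  archimedean (mkℚ (ℤ.+ zero) _ _) (*<* (ℤ.+<+ ()))
  archimedean (mkℚ ℤ.-[1+ _ ] _ _) (*<* ())
  archimedean ε@(mkℚ ℤ.+[1+ a ] d _) _ = suc d , ratio<ε
    where
    ratio<ε : ∀ p q → suc d ℕ.* p ℕ.< q → ratio p q < ε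
    ratio<ε p q@(suc _) [1+d]p<q = subst (ι p * 1/ ι q <_) εq/q≡ε (*-monoˡ-<-pos (1/ ι q) p<εq)
      where
      εq/q≡ε : ε * ι q * 1/ ι q ≡ ε
      εq/q≡ε = trans (*-assoc ε (ι q) (1/ ι q)) (trans (cong (ε *_) (*-inverseʳ (ι q))) (*-identityʳ ε))

      p[1+d]<[1+a]q : ℤ.+ p ℤ.* ℤ.+ (suc d ℕ.* 1) ℤ.< (ℤ.+ suc a ℤ.* ℤ.+ q) ℤ.* ℤ.+ 1
      p[1+d]<[1+a]q =
        subst₂ ℤ._<_ (ℤₚ.pos-* p (suc d ℕ.* 1))
                     (trans (ℤₚ.pos-* (suc a ℕ.* q) 1) (cong (ℤ._* ℤ.+ 1) (ℤₚ.pos-* (suc a) q)))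
          (ℤ.+<+ (begin-strict
            p ℕ.* (suc d ℕ.* 1) ≡⟨ ℕ-Solver.solve (p ∷ d ∷ []) ⟩
            suc d ℕ.* p         <⟨ [1+d]p<q ⟩
            q                   ≤⟨ ℕₚ.m≤n*m q (suc a) ⟩
            suc a ℕ.* q         ≡⟨ ℕₚ.*-identityʳ (suc a ℕ.* q) ⟨
            suc a ℕ.* q ℕ.* 1   ∎))
        where open ℕₚ.≤-Reasoning

      p<εq : ι p < ε * ι q
      p<εq = toℚᵘ-cancel-< (ℚᵘₚ.<-respʳ-≃ (ℚᵘₚ.≃-sym (toℚᵘ-homo-* ε (ι q))) (ℚᵘ.*<* p[1+d]<[1+a]q))

module Plans where

  open import Defs using (IsPerfectSquare)
  open import Data.Nat
  open import Data.Nat.Properties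
  open import Data.Nat.Tactic.RingSolver using (solve-∀; solve)
  open import Data.List using (_∷_; [])
  open import Data.Product using (_×_; _,_; proj₁; proj₂)
  open import Data.Sum using (_⊎_; inj₁; inj₂)
  open import Data.Empty using (⊥-elim)
  open import Relation.Binary.PropositionalEquality
  open import Relation.Nullary using (¬_; yes; no)

  ⌊√_⌋ : ℕ → ℕ
  ⌊√ zero ⌋  = zero
  ⌊√ suc n ⌋ with suc ⌊√ n ⌋ * suc ⌊√ n ⌋ ≤? suc n
  ... | yes _ = suc ⌊√ n ⌋
  ... | no  _ = ⌊√ n ⌋

  ⌊√n⌋-spec : ∀ n → ⌊√ n ⌋ * ⌊√ n ⌋ ≤ n × n < suc ⌊√ n ⌋ * suc ⌊√ n ⌋
  ⌊√n⌋-spec zero = z≤n , z<s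
  ⌊√n⌋-spec (suc n) with suc ⌊√ n ⌋ * suc ⌊√ n ⌋ ≤? suc n | ⌊√n⌋-spec n
  ... | yes r²≤1+n | _ , n<r² = r²≤1+n , ≤-<-trans n<r² (*-mono-< (n<1+n r) (n<1+n r))
    where
    r : ℕ
    r = suc ⌊√ n ⌋
  ... | no  r²≰1+n | r²≤n , _ = m≤n⇒m≤1+n r²≤n , ≰⇒> r²≰1+n

  record Difference : Set where
    constructor difference
    field
      s b δ : ℕ

  data Shape : ℕ → Set where
    none : Shape 0
    odd  : ∀ b → Shape (1 + 2 * b)
    two  : ∀ b → Shape (2 + 4 * b)
    four : ∀ b → Shape (4 + 4 * b)

  shape : ∀ e → Shape e
  shape 0 = none
  shape 1 = odd 0
  shape 2 = two 0
  shape 3 = odd 1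
  shape (suc (suc (suc (suc e)))) = shift (shape e)
    where
    odd-shift : ∀ b → 1 + 2 * (2 + b) ≡ 4 + (1 + 2 * b)
    odd-shift = solve-∀
    two-shift : ∀ b → 2 + 4 * (1 + b) ≡ 4 + (2 + 4 * b)
    two-shift = solve-∀
    four-shift : ∀ b → 4 + 4 * (1 + b) ≡ 4 + (4 + 4 * b)
    four-shift = solve-∀

    shift : ∀ {e} → Shape e → Shape (4 + e)
    shift none     = four 0
    shift (odd b)  = subst Shape (odd-shift b) (odd (2 + b))
    shift (two b)  = subst Shape (two-shift b) (two (1 + b))
    shift (four b) = subst Shape (four-shift b) (four (1 + b))

  shape-difference : ∀ {e} → Shape e → Difference
  shape-difference none     = difference 1 1 1  -- junk: e = 0 is excluded by m < e
  shape-difference (odd b)  = difference 1 b 1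
  shape-difference (two b)  = difference 2 b 1
  shape-difference (four b) = difference 1 b 2

  record Admissible (m e : ℕ) (D : Difference) : Set where
    open Difference D
    field
      e+sb²≡s[b+δ]² : e + s * b * b ≡ s * (b + δ) * (b + δ)
      0<s           : 0 < s
      0<b           : 0 < b
      0<δ           : 0 < δ
      δ≤2           : δ ≤ 2
      s[b+δ]≤1+m    : s * (b + δ) ≤ suc m
      b+δ≤m         : b + δ ≤ m
      m<4[1+b]      : m < 4 * suc b

  admissible : ∀ {m e} → 2 ≤ m → m < e → e ≤ 2 * m → e ≢ 4 → (sh : Shape e) →
               Admissible m e (shape-difference sh)
  admissible 2≤m () e≤2m e≢4 none
  admissible {m} 2≤m m<e e≤2m e≢4 (odd b) = record
    { e+sb²≡s[b+δ]² = identity b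
    ; 0<s           = z<s
    ; 0<b           = *-cancelˡ-≤ 2 (≤-pred (≤-trans (s≤s 2≤m) m<e))
    ; 0<δ           = z<s
    ; δ≤2           = s≤s z≤n
    ; s[b+δ]≤1+m    = begin
        1 * (b + 1) ≡⟨ solve (b ∷ []) ⟩
        suc b       ≤⟨ b<m ⟩
        m           ≤⟨ n≤1+n m ⟩
        suc m       ∎
    ; b+δ≤m         = begin
        b + 1       ≡⟨ +-comm b 1 ⟩
        suc b       ≤⟨ b<m ⟩
        m           ∎
    ; m<4[1+b]      = begin-strict
        m                       <⟨ m<e ⟩
        1 + 2 * b               ≤⟨ m≤m+n (1 + 2 * b) (3 + 2 * b) ⟩
        1 + 2 * b + (3 + 2 * b) ≡⟨ solve (b ∷ []) ⟩
        4 * suc b               ∎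
    }
    where
    open ≤-Reasoning
    identity : ∀ b → 1 + 2 * b + 1 * b * b ≡ 1 * (b + 1) * (b + 1)
    identity = solve-∀
    b<m : b < m
    b<m = *-cancelˡ-< 2 b m e≤2m
  admissible {m} 2≤m m<e e≤2m e≢4 (two b) = record
    { e+sb²≡s[b+δ]² = identity b
    ; 0<s           = z<s
    ; 0<b           = *-cancelˡ-< 4 0 b (+-cancelˡ-< 2 0 (4 * b) (≤-trans (s≤s 2≤m) m<e))
    ; 0<δ           = z<s
    ; δ≤2           = s≤s z≤n
    ; s[b+δ]≤1+m    = begin
        2 * (b + 1)     ≡⟨ solve (b ∷ []) ⟩
        suc (1 + 2 * b) ≤⟨ s≤s 1+2b≤m ⟩
        suc m           ∎
    ; b+δ≤m         = begin
        b + 1           ≤⟨ m≤m+n (b + 1) b ⟩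
        b + 1 + b       ≡⟨ solve (b ∷ []) ⟩
        1 + 2 * b       ≤⟨ 1+2b≤m ⟩
        m               ∎
    ; m<4[1+b]      = begin-strict
        m               <⟨ m<e ⟩
        2 + 4 * b       ≤⟨ m≤m+n (2 + 4 * b) 2 ⟩
        2 + 4 * b + 2   ≡⟨ solve (b ∷ []) ⟩
        4 * suc b       ∎
    }
    where
    open ≤-Reasoning
    identity : ∀ b → 2 + 4 * b + 2 * b * b ≡ 2 * (b + 1) * (b + 1)
    identity = solve-∀
    1+2b≤m : 1 + 2 * b ≤ m
    1+2b≤m = *-cancelˡ-≤ 2 (begin
      2 * (1 + 2 * b) ≡⟨ solve (b ∷ []) ⟩
      2 + 4 * b       ≤⟨ e≤2m ⟩
      2 * m           ∎)
  admissible {m} 2≤m m<e e≤2m e≢4 (four b) = record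
    { e+sb²≡s[b+δ]² = identity b
    ; 0<s           = z<s
    ; 0<b           = n≢0⇒n>0 (λ b≡0 → e≢4 (cong (λ b → 4 + 4 * b) b≡0))
    ; 0<δ           = z<s
    ; δ≤2           = ≤-refl
    ; s[b+δ]≤1+m    = begin
        1 * (b + 2) ≡⟨ +-identityʳ (b + 2) ⟩
        b + 2       ≤⟨ b+2≤m ⟩
        m           ≤⟨ n≤1+n m ⟩
        suc m       ∎
    ; b+δ≤m         = b+2≤m
    ; m<4[1+b]      = begin-strict
        m           <⟨ m<e ⟩
        4 + 4 * b   ≡⟨ solve (b ∷ []) ⟩
        4 * suc b   ∎
    }
    where
    open ≤-Reasoning
    identity : ∀ b → 4 + 4 * b + 1 * b * b ≡ 1 * (b + 2) * (b + 2)
    identity = solve-∀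
    b+2≤m : b + 2 ≤ m
    b+2≤m = *-cancelˡ-≤ 2 (begin
      2 * (b + 2)           ≤⟨ m≤m+n (2 * (b + 2)) (2 * b) ⟩
      2 * (b + 2) + 2 * b   ≡⟨ solve (b ∷ []) ⟩
      4 + 4 * b             ≤⟨ e≤2m ⟩
      2 * m                 ∎)

  data Sign : Set where
    excess deficit : Sign

  -- Encodes n = L² ± s((b+δ)² − b²); block-side and other-side are the d and l of two-size-square.
  record Plan : Set where
    constructor plan
    field
      sign : Sign
      L    : ℕ
      diff : Difference

  block-side other-side : Plan → ℕ
  block-side (plan excess  _ (difference _ b δ)) = b
  block-side (plan deficit _ (difference _ b δ)) = b + δ
  other-side (plan excess  _ (difference _ b δ)) = b + δ
  other-side (plan deficit _ (difference _ b δ)) = b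

  record Valid (n : ℕ) (P : Plan) : Set where
    open Plan P
    open Difference diff
    field
      0<s       : 0 < s
      0<b       : 0 < b
      0<δ       : 0 < δ
      δ≤2       : δ ≤ 2
      s·d≤L     : s * block-side P ≤ L
      d<L       : block-side P < L
      count     : n + s * block-side P * block-side P ≡ L * L + s * other-side P * other-side P
      n<[4+4b]² : n < 4 * suc b * (4 * suc b)

  n<[1+m]²⇒n<k² : ∀ {n m k} → n < suc m * suc m → m < k → n < k * k
  n<[1+m]²⇒n<k² n<[1+m]² m<k = <-≤-trans n<[1+m]² (*-mono-≤ m<k m<k)

  excess-valid : ∀ {n m e D} → n ≡ m * m + e → n < suc m * suc m → Admissible m e D →
                 Valid n (plan excess m D)
  excess-valid {n} {m} {e} {difference s b δ} n≡m²+e n<[1+m]² A = record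
    { 0<s       = 0<s
    ; 0<b       = 0<b
    ; 0<δ       = 0<δ
    ; δ≤2       = δ≤2
    ; s·d≤L     = ≤-pred (≤-trans (*-monoʳ-< s {{>-nonZero 0<s}} b<b+δ) s[b+δ]≤1+m)
    ; d<L       = <-≤-trans b<b+δ b+δ≤m
    ; count     = begin
        n + s * b * b                 ≡⟨ cong (_+ s * b * b) n≡m²+e ⟩
        m * m + e + s * b * b         ≡⟨ +-assoc (m * m) e (s * b * b) ⟩
        m * m + (e + s * b * b)       ≡⟨ cong (m * m +_) e+sb²≡s[b+δ]² ⟩
        m * m + s * (b + δ) * (b + δ) ∎
    ; n<[4+4b]² = n<[1+m]²⇒n<k² n<[1+m]² m<4[1+b]
    }
    where
    open Admissible A
    open ≡-Reasoning
    b<b+δ : b < b + δ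
    b<b+δ = m<m+n b 0<δ

  deficit-valid : ∀ {n m e D} → n + e ≡ suc m * suc m → 0 < e → Admissible m e D →
                  Valid n (plan deficit (suc m) D)
  deficit-valid {n} {m} {e} {difference s b δ} n+e≡[1+m]² 0<e A = record
    { 0<s       = 0<s
    ; 0<b       = 0<b
    ; 0<δ       = 0<δ
    ; δ≤2       = δ≤2
    ; s·d≤L     = s[b+δ]≤1+m
    ; d<L       = s≤s b+δ≤m
    ; count     = begin
        n + s * (b + δ) * (b + δ) ≡⟨ cong (n +_) e+sb²≡s[b+δ]² ⟨
        n + (e + s * b * b)       ≡⟨ +-assoc n e (s * b * b) ⟨
        n + e + s * b * b         ≡⟨ cong (_+ s * b * b) n+e≡[1+m]² ⟩
        suc m * suc m + s * b * b ∎
    ; n<[4+4b]² = n<[1+m]²⇒n<k² (subst (n <_) n+e≡[1+m]² (m<m+n n 0<e)) m<4[1+b]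
    }
    where
    open Admissible A
    open ≡-Reasoning

  generic-plan : ℕ → ℕ → Plan
  generic-plan m j with m <? j
  ... | yes _ = plan excess m (shape-difference (shape j))
  ... | no  _ = plan deficit (suc m) (shape-difference (shape (suc (2 * m) ∸ j)))

  m<4≤2m⇒m≡2⊎m≡3 : ∀ {m} → m < 4 → 4 ≤ 2 * m → m ≡ 2 ⊎ m ≡ 3
  m<4≤2m⇒m≡2⊎m≡3 {2} _ _ = inj₁ refl
  m<4≤2m⇒m≡2⊎m≡3 {3} _ _ = inj₂ refl
  m<4≤2m⇒m≡2⊎m≡3 {suc (suc (suc (suc _)))} (s≤s (s≤s (s≤s (s≤s ())))) _
  m<4≤2m⇒m≡2⊎m≡3 {0} _ ()
  m<4≤2m⇒m≡2⊎m≡3 {1} _ (s≤s (s≤s ()))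

  [1+m]²≡m²+[1+2m] : ∀ m → suc m * suc m ≡ m * m + suc (2 * m)
  [1+m]²≡m²+[1+2m] = solve-∀

  j+e≡1+2m⇒m<e≤2m : ∀ {m j e} → j + e ≡ suc (2 * m) → 0 < j → j ≤ m → m < e × e ≤ 2 * m
  j+e≡1+2m⇒m<e≤2m {m} {j} {e} j+e≡1+2m 0<j j≤m =
    +-cancelˡ-≤ j (suc m) e (begin
      j + suc m     ≤⟨ +-monoˡ-≤ (suc m) j≤m ⟩
      m + suc m     ≡⟨ solve (m ∷ []) ⟩
      suc (2 * m)   ≡⟨ j+e≡1+2m ⟨
      j + e         ∎)
    , ≤-pred (subst (suc e ≤_) j+e≡1+2m (+-monoˡ-≤ e 0<j))
    where open ≤-Reasoning

  generic-plan-valid : ∀ {n m j} → n ≡ m * m + j → 0 < j → j ≤ 2 * m → 2 ≤ m →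
                       6 ≤ n → n ≢ 8 → n ≢ 12 → n ≢ 13 → Valid n (generic-plan m j)
  generic-plan-valid {n} {m} {j} n≡m²+j 0<j j≤2m 2≤m 6≤n n≢8 n≢12 n≢13 with m <? j
  ... | yes m<j = excess-valid n≡m²+j n<[1+m]² (admissible 2≤m m<j j≤2m j≢4 (shape j))
    where
    n<[1+m]² : n < suc m * suc m
    n<[1+m]² = subst₂ _<_ (sym n≡m²+j) (sym ([1+m]²≡m²+[1+2m] m)) (+-monoʳ-< (m * m) (s≤s j≤2m))
    j≢4 : j ≢ 4
    j≢4 j≡4 with m<4≤2m⇒m≡2⊎m≡3 (subst (m <_) j≡4 m<j) (subst (_≤ 2 * m) j≡4 j≤2m)
    ... | inj₁ refl = n≢8 (trans n≡m²+j (cong (4 +_) j≡4))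
    ... | inj₂ refl = n≢13 (trans n≡m²+j (cong (9 +_) j≡4))
  ... | no m≮j = deficit-valid n+e≡[1+m]² (≤-trans (s≤s z≤n) m<e) (admissible 2≤m m<e e≤2m e≢4 (shape e))
    where
    e : ℕ
    e = suc (2 * m) ∸ j
    j+e≡1+2m : j + e ≡ suc (2 * m)
    j+e≡1+2m = m+[n∸m]≡n (m≤n⇒m≤1+n j≤2m)
    n+e≡[1+m]² : n + e ≡ suc m * suc m
    n+e≡[1+m]² = begin
      n + e               ≡⟨ cong (_+ e) n≡m²+j ⟩
      m * m + j + e       ≡⟨ +-assoc (m * m) j e ⟩
      m * m + (j + e)     ≡⟨ cong (m * m +_) j+e≡1+2m ⟩
      m * m + suc (2 * m) ≡⟨ [1+m]²≡m²+[1+2m] m ⟨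
      suc m * suc m       ∎
      where open ≡-Reasoning
    m<e : m < e
    m<e = proj₁ (j+e≡1+2m⇒m<e≤2m j+e≡1+2m 0<j (≮⇒≥ m≮j))
    e≤2m : e ≤ 2 * m
    e≤2m = proj₂ (j+e≡1+2m⇒m<e≤2m j+e≡1+2m 0<j (≮⇒≥ m≮j))
    e≢4 : e ≢ 4
    e≢4 e≡4 with m<4≤2m⇒m≡2⊎m≡3 (subst (m <_) e≡4 m<e) (subst (_≤ 2 * m) e≡4 e≤2m)
    ... | inj₁ refl =
      <⇒≱ (s≤s (≤-reflexive (+-cancelʳ-≡ 4 n 5 (subst (λ e → n + e ≡ 9) e≡4 n+e≡[1+m]²)))) 6≤n
    ... | inj₂ refl = n≢12 (+-cancelʳ-≡ 4 n 12 (subst (λ e → n + e ≡ 16) e≡4 n+e≡[1+m]²))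

  4≤n<[1+m]²⇒2≤m : ∀ {n m} → 4 ≤ n → n < suc m * suc m → 2 ≤ m
  4≤n<[1+m]²⇒2≤m {m = 0}           4≤n n<1 = ⊥-elim (<⇒≱ n<1 (≤-trans (s≤s z≤n) 4≤n))
  4≤n<[1+m]²⇒2≤m {m = 1}           4≤n n<4 = ⊥-elim (<⇒≱ n<4 4≤n)
  4≤n<[1+m]²⇒2≤m {m = suc (suc m)} _   _   = s≤s (s≤s z≤n)

  plan-of : ℕ → Plan
  plan-of n with n ≟ 8 | n ≟ 12 | n ≟ 13
  ... | yes _ | _     | _     = plan deficit 4 (difference 1 1 2)
  ... | no _  | yes _ | _     = plan excess 3 (difference 1 1 1)
  ... | no _  | no _  | yes _ = plan deficit 4 (difference 1 1 1)
  ... | no _  | no _  | no _  = generic-plan ⌊√ n ⌋ (n ∸ ⌊√ n ⌋ * ⌊√ n ⌋)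

  plan-valid : ∀ n → 6 ≤ n → ¬ IsPerfectSquare n → Valid n (plan-of n)
  plan-valid n 6≤n ¬□ with n ≟ 8 | n ≟ 12 | n ≟ 13
  ... | yes refl | _        | _        = record
    { 0<s = z<s ; 0<b = z<s ; 0<δ = z<s ; δ≤2 = ≤-refl
    ; s·d≤L = ≤ᵇ⇒≤ _ _ _ ; d<L = ≤ᵇ⇒≤ _ _ _ ; count = refl ; n<[4+4b]² = ≤ᵇ⇒≤ _ _ _ }
  ... | no _     | yes refl | _        = record
    { 0<s = z<s ; 0<b = z<s ; 0<δ = z<s ; δ≤2 = ≤ᵇ⇒≤ _ _ _
    ; s·d≤L = ≤ᵇ⇒≤ _ _ _ ; d<L = ≤ᵇ⇒≤ _ _ _ ; count = refl ; n<[4+4b]² = ≤ᵇ⇒≤ _ _ _ }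
  ... | no _     | no _     | yes refl = record
    { 0<s = z<s ; 0<b = z<s ; 0<δ = z<s ; δ≤2 = ≤ᵇ⇒≤ _ _ _
    ; s·d≤L = ≤ᵇ⇒≤ _ _ _ ; d<L = ≤ᵇ⇒≤ _ _ _ ; count = refl ; n<[4+4b]² = ≤ᵇ⇒≤ _ _ _ }
  ... | no n≢8   | no n≢12  | no n≢13  =
    generic-plan-valid n≡m²+j 0<j j≤2m (4≤n<[1+m]²⇒2≤m (≤-trans (≤ᵇ⇒≤ 4 6 _) 6≤n) n<[1+m]²)
                       6≤n n≢8 n≢12 n≢13
    where
    m j : ℕ
    m = ⌊√ n ⌋
    j = n ∸ m * m
    n<[1+m]² : n < suc m * suc m
    n<[1+m]² = proj₂ (⌊√n⌋-spec n)
    n≡m²+j : n ≡ m * m + j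
    n≡m²+j = sym (m+[n∸m]≡n (proj₁ (⌊√n⌋-spec n)))
    0<j : 0 < j
    0<j = n≢0⇒n>0 (λ j≡0 →
      ¬□ (m , sym (trans n≡m²+j (trans (cong (m * m +_) j≡0) (+-identityʳ (m * m))))))
    j≤2m : j ≤ 2 * m
    j≤2m = ≤-pred (+-cancelˡ-< (m * m) j (suc (2 * m))
             (subst₂ _<_ n≡m²+j ([1+m]²≡m²+[1+2m] m) n<[1+m]²))

module Construction where

  open import Defs
  open import Data.Nat
  open import Data.Nat.Properties
  open import Data.Rational as ℚ using (ℚ; 0ℚ; 1ℚ)
  open import Data.Fin using (Fin)
  open import Data.Product as Σ using (Σ; ∃; _×_; _,_)
  open import Data.Sum as ⊎ using (_⊎_)
  open import Function using (_∘_)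
  open import Relation.Binary.PropositionalEquality
  open import Relation.Nullary using (¬_)
  open Embedding
  open RectangleTilings
  open TwoSizeLayout
  open Ratios
  open Plans

  TiledByTwoSizes : ℕ → ℚ → Set
  TiledByTwoSizes n ρ =
    Σ Square λ S → Σ (Fin n → Square) λ T →
      IsTiling S T
      × (∀ i → side (T i) ℚ.< side S)
      × Σ ℚ λ a → Σ ℚ λ b →
          b ℚ.< a
          × a ≡ ρ ℚ.* b
          × (∀ i → side (T i) ≡ a ⊎ side (T i) ≡ b)
          × (∃ λ i → side (T i) ≡ a)
          × (∃ λ j → side (T j) ≡ b)

  two-size-tiled : ∀ {a b Z n} .{{_ : NonZero b}} → TwoSizeTiling a b Z n → b < a → a < Z →
                   TiledByTwoSizes n (ratio a b)
  two-size-tiled {a} {b} {Z} t b<a a<Z =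
    square 0ℚ 0ℚ (ι Z) , ⟦_⟧ ∘ tiles tiling , isTiling tiling , ι-mono-< ∘ size<Z ,
    ι a , ι b , ι-mono-< b<a , ι≡ratio*ι a b ,
    ⊎.map (cong ι) (cong ι) ∘ sizes-ok tiling , Σ.map₂ (cong ι) has-a , Σ.map₂ (cong ι) has-b
    where
    open TwoSizeTiling t
    size<Z : ∀ i → size (tiles tiling i) < Z
    size<Z i = ⊎.[ (λ c≡a → subst (_< Z) (sym c≡a) a<Z)
                 , (λ c≡b → subst (_< Z) (sym c≡b) (<-trans b<a a<Z)) ]′ (sizes-ok tiling i)

  plan-ratio : Plan → ℚ
  plan-ratio (plan _ _ (difference _ b δ)) = ratio (b + δ) b

  plan-tiled : ∀ {n} P → Valid n P → TiledByTwoSizes n (plan-ratio P)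
  plan-tiled (plan excess L (difference s b δ)) V =
    two-size-tiled (swap-sizes (two-size-square s b (b + δ) s·d≤L d<L count)) (m<m+n b 0<δ)
      (subst (b + δ <_) (*-comm (b + δ) L) (m<m*n (b + δ) L (≤-<-trans 0<b d<L)))
    where
    open Valid V
    instance
      s≢0 : NonZero s
      s≢0 = >-nonZero 0<s
      b≢0 : NonZero b
      b≢0 = >-nonZero 0<b
      b+δ≢0 : NonZero (b + δ)
      b+δ≢0 = >-nonZero (<-≤-trans 0<b (m≤m+n b δ))
  plan-tiled (plan deficit L (difference s b δ)) V =
    two-size-tiled (two-size-square s (b + δ) b s·d≤L d<L count) (m<m+n b 0<δ) (<-≤-trans d<L (m≤m*n L b))
    where
    open Valid V
    instance
      s≢0 : NonZero s
      s≢0 = >-nonZero 0<s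
      b≢0 : NonZero b
      b≢0 = >-nonZero 0<b
      b+δ≢0 : NonZero (b + δ)
      b+δ≢0 = >-nonZero (<-≤-trans 0<b (m≤m+n b δ))

  1≤plan-ratio : ∀ {n} P → Valid n P → 1ℚ ℚ.≤ plan-ratio P
  1≤plan-ratio (plan _ _ (difference s b δ)) V = 1≤ratio {{>-nonZero 0<b}} (m≤m+n b δ)
    where open Valid V

  a²≤n<c²⇒a<c : ∀ {a c n} → a * a ≤ n → n < c * c → a < c
  a²≤n<c²⇒a<c a²≤n n<c² = ≰⇒> (λ c≤a → <⇒≱ n<c² (≤-trans (*-mono-≤ c≤a c≤a) a²≤n))

  plan-ratio-close : ∀ {n} P ε K → (∀ p q → K * p < q → ratio p q ℚ.< ε) → Valid n P →
                     4 * suc (K * 2) * (4 * suc (K * 2)) ≤ n → plan-ratio P ℚ.- 1ℚ ℚ.< ε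
  plan-ratio-close (plan _ _ (difference s b δ)) ε K ratio<ε V N≤n =
    subst (ℚ._< ε) (sym (ratio[q+δ,q]-1≡ratio[δ,q] b δ)) (ratio<ε δ b (≤-<-trans (*-monoʳ-≤ K δ≤2) 2K<b))
    where
    open Valid V
    instance
      b≢0 : NonZero b
      b≢0 = >-nonZero 0<b
    2K<b : K * 2 < b
    2K<b = ≤-pred (*-cancelˡ-< 4 (suc (K * 2)) (suc b) (a²≤n<c²⇒a<c N≤n n<[4+4b]²))

  plan-ratio→1 : ∀ ε → 0ℚ ℚ.< ε → ∃ λ N → ∀ n → 6 ≤ n → ¬ IsPerfectSquare n → N ≤ n →
                 plan-ratio (plan-of n) ℚ.- 1ℚ ℚ.< ε
  plan-ratio→1 ε 0<ε with archimedean ε 0<ε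
  ... | K , ratio<ε = 4 * suc (K * 2) * (4 * suc (K * 2)) ,
        λ n 6≤n ¬□ N≤n → plan-ratio-close (plan-of n) ε K ratio<ε (plan-valid n 6≤n ¬□) N≤n

open import Defs
open import Data.Nat using (ℕ) renaming (_≤_ to _≤ℕ_)
open import Data.Rational using (ℚ; _≤_; _<_; _*_; _-_; 0ℚ; 1ℚ)
open import Data.Fin using (Fin)
open import Data.Product using (Σ; ∃; _×_; _,_)
open import Data.Sum using (_⊎_)
open import Relation.Binary.PropositionalEquality using (_≡_)
open import Relation.Nullary using (¬_)
open Plans using (plan-of; plan-valid)
open Construction using (plan-ratio; 1≤plan-ratio; plan-ratio→1; plan-tiled)

r : ℕ → ℚ
r n = plan-ratio (plan-of n)

theorem1 : Σ (ℕ → ℚ) λ r →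
    (∀ n → 6 ≤ℕ n → ¬ IsPerfectSquare n → 1ℚ ≤ r n)
  × (∀ (ε : ℚ) → 0ℚ < ε → ∃ λ N → ∀ n → 6 ≤ℕ n → ¬ IsPerfectSquare n → N ≤ℕ n → r n - 1ℚ < ε)
  × (∀ n → 6 ≤ℕ n → ¬ IsPerfectSquare n →
       Σ Square λ S → Σ (Fin n → Square) λ T →
         IsTiling S T
         × (∀ i → side (T i) < side S)
         × Σ ℚ λ a → Σ ℚ λ b →
             b < a
             × a ≡ r n * b
             × (∀ i → side (T i) ≡ a ⊎ side (T i) ≡ b)
             × (∃ λ i → side (T i) ≡ a)
             × (∃ λ j → side (T j) ≡ b))
theorem1 =
    r
  , (λ n 6≤n ¬□ → 1≤plan-ratio (plan-of n) (plan-valid n 6≤n ¬□))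
  , plan-ratio→1
  , (λ n 6≤n ¬□ → plan-tiled (plan-of n) (plan-valid n 6≤n ¬□))
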